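{- For every $e\in\mathcal E(X)$ and every finite $A\subseteq X$, $t_A\leqq e$ if and only if $t_A\lesssim e$.
   Context: Fix a set $X$ of variables. Expressions $\mathcal E(X)$ are generated by $e,f::= x \mid 0\mid 1\mid e+f\mid e\cdot f\mid e\cap f\mid e^+\mid \overline{e}$. For a finite $A=\{a_1,\dots,a_n\}\subseteq X$ (any order), $t_A=a_1\cap(a_2\cap(\cdots\cap(a_n\cap 1)\cdots))$, $t_\emptyset=1$. Semantics: for an alphabet $\Sigma$ and $\sigma:X\to\mathcal P(\Sigma^\star)$, $[\![x]\!]_\sigma=\sigma(x)$, $[\![0]\!]_\sigma=\emptyset$, $[\![1]\!]_\sigma=\{\epsilon\}$, $+$ union, $\cap$ intersection, $\cdot$ concatenation, $e^+$ is $\bigcup_{n\ge1}[\![e]\!]_\sigma^n$, $\overline e$ the set of reversed words. $e\lesssim f$ means $[\![e]\!]_\sigma\subseteq[\![f]\!]_\sigma$ for all $\Sigma,\sigma$. $e\leqq f$ means $e+f\equiv f$, where $\equiv$ is the smallest congruence on $\mathcal E(X)$ containing, for all $e,f,g$: $e+f=f+e$; $e+(f+g)=(e+f)+g$; $e+0=e$; $e\cap f=f\cap e$; $e\cap e=e$; $e\cap(f\cap g)=(e\cap f)\cap g$; $(e+f)\cap g=e\cap g+f\cap g$; $(e\cap f)+e=e$; $e\cdot(f\cdot g)=(e\cdot f)\cdot g$; $e\cdot 0=0=0\cdot e$; $(e+f)\cdot g=e\cdot g+f\cdot g$; $e\cdot(f+g)=e\cdot f+e\cdot g$; $e^+=e+e\cdot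 e^+$; $e^+=e+e^+\cdot e$; $\overline{\overline e}=e$; $\overline{e+f}=\overline e+\overline f$; $\overline{e\cdot f}=\overline f\cdot\overline e$; $\overline{e\cap f}=\overline e\cap\overline f$; $\overline{e^+}=\overline e^{\,+}$; $1\cdot e=e=e\cdot 1$; $1\cap(e\cdot f)=1\cap(e\cap f)$; $1\cap\overline e=1\cap e$; $(1\cap e)\cdot f=f\cdot(1\cap e)$; $((1\cap e)\cdot f)\cap g=(1\cap e)\cdot(f\cap g)$; $(g+(1\cap e)\cdot f)^+=g^++(1\cap e)\cdot(g+f)^+$; and closed under: if $e\cdot f+f\equiv f$ then $e^+\cdot f+f\equiv f$; if $f\cdot e+f\equiv f$ then $f\cdot e^++f\equiv f$. -}

module Defs where

open import Level using (Level; suc; _⊔_)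
open import Data.List using (List; []; _∷_; _++_; reverse)
open import Data.Product using (Σ; _×_; _,_; ∃)
open import Data.Sum using (_⊎_)
open import Data.Empty using (⊥)
open import Relation.Binary.PropositionalEquality using (_≡_)

data Expr (X : Set) : Set where
  var  : X → Expr X
  𝟘 𝟙  : Expr X
  _⊕_  : Expr X → Expr X → Expr X
  _⊙_  : Expr X → Expr X → Expr X
  _⊓_  : Expr X → Expr X → Expr X
  _⁺   : Expr X → Expr X
  conv : Expr X → Expr X

infixl 6 _⊕_
infixl 7 _⊙_
infixl 8 _⊓_
infix  9 _⁺

-- t_A for A given as a list a₁ ∷ … ∷ aₙ: a₁ ∩ (a₂ ∩ ( … (aₙ ∩ 1)))
t : {X : Set} → List X → Expr X
t []       = 𝟙
t (a ∷ as) = var a ⊓ t as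

Lang : Set → Set₁
Lang A = List A → Set

data Plus {A : Set} (L : Lang A) : List A → Set where
  one  : ∀ {w} → L w → Plus L w
  more : ∀ {u v} → L u → Plus L v → Plus L (u ++ v)

⟦_⟧ : {X A : Set} → Expr X → (X → Lang A) → Lang A
⟦ var x ⟧ σ w  = σ x w
⟦ 𝟘 ⟧ σ w      = ⊥
⟦ 𝟙 ⟧ σ w      = w ≡ []
⟦ e ⊕ f ⟧ σ w  = ⟦ e ⟧ σ w ⊎ ⟦ f ⟧ σ w
⟦ e ⊙ f ⟧ σ w  = Σ _ λ u → Σ _ λ v → (w ≡ u ++ v) × (⟦ e ⟧ σ u × ⟦ f ⟧ σ v)
⟦ e ⊓ f ⟧ σ w  = ⟦ e ⟧ σ w × ⟦ f ⟧ σ w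
⟦ e ⁺ ⟧ σ w    = Plus (⟦ e ⟧ σ) w
⟦ conv e ⟧ σ w = ⟦ e ⟧ σ (reverse w)

_≲_ : {X : Set} → Expr X → Expr X → Set₁
_≲_ {X} e f = (A : Set) (σ : X → Lang A) (w : List A) → ⟦ e ⟧ σ w → ⟦ f ⟧ σ w

infix 4 _≐_
data _≐_ {X : Set} : Expr X → Expr X → Set where
  refl≐  : ∀ {e} → e ≐ e
  sym≐   : ∀ {e f} → e ≐ f → f ≐ e
  trans≐ : ∀ {e f g} → e ≐ f → f ≐ g → e ≐ g
  ⊕-cong : ∀ {e e' f f'} → e ≐ e' → f ≐ f' → e ⊕ f ≐ e' ⊕ f'
  ⊙-cong : ∀ {e e' f f'} → e ≐ e' → f ≐ f' → e ⊙ f ≐ e' ⊙ f'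
  ⊓-cong : ∀ {e e' f f'} → e ≐ e' → f ≐ f' → e ⊓ f ≐ e' ⊓ f'
  ⁺-cong : ∀ {e e'} → e ≐ e' → e ⁺ ≐ e' ⁺
  conv-cong : ∀ {e e'} → e ≐ e' → conv e ≐ conv e'
  ⊕-comm  : ∀ {e f} → e ⊕ f ≐ f ⊕ e
  ⊕-assoc : ∀ {e f g} → e ⊕ (f ⊕ g) ≐ (e ⊕ f) ⊕ g
  ⊕-zero  : ∀ {e} → e ⊕ 𝟘 ≐ e
  ⊓-comm  : ∀ {e f} → e ⊓ f ≐ f ⊓ e
  ⊓-idem  : ∀ {e} → e ⊓ e ≐ e
  ⊓-assoc : ∀ {e f g} → e ⊓ (f ⊓ g) ≐ (e ⊓ f) ⊓ g
  ⊓-distr : ∀ {e f g} → (e ⊕ f) ⊓ g ≐ e ⊓ g ⊕ f ⊓ g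
  absorb  : ∀ {e f} → (e ⊓ f) ⊕ e ≐ e
  ⊙-assoc : ∀ {e f g} → e ⊙ (f ⊙ g) ≐ (e ⊙ f) ⊙ g
  ⊙-zeroʳ : ∀ {e} → e ⊙ 𝟘 ≐ 𝟘
  ⊙-zeroˡ : ∀ {e} → 𝟘 ⊙ e ≐ 𝟘
  ⊙-distrʳ : ∀ {e f g} → (e ⊕ f) ⊙ g ≐ e ⊙ g ⊕ f ⊙ g
  ⊙-distrˡ : ∀ {e f g} → e ⊙ (f ⊕ g) ≐ e ⊙ f ⊕ e ⊙ g
  ⁺-unfoldˡ : ∀ {e} → e ⁺ ≐ e ⊕ e ⊙ e ⁺
  ⁺-unfoldʳ : ∀ {e} → e ⁺ ≐ e ⊕ e ⁺ ⊙ e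
  conv-inv  : ∀ {e} → conv (conv e) ≐ e
  conv-⊕    : ∀ {e f} → conv (e ⊕ f) ≐ conv e ⊕ conv f
  conv-⊙    : ∀ {e f} → conv (e ⊙ f) ≐ conv f ⊙ conv e
  conv-⊓    : ∀ {e f} → conv (e ⊓ f) ≐ conv e ⊓ conv f
  conv-⁺    : ∀ {e} → conv (e ⁺) ≐ (conv e) ⁺
  ⊙-unitˡ   : ∀ {e} → 𝟙 ⊙ e ≐ e
  ⊙-unitʳ   : ∀ {e} → e ⊙ 𝟙 ≐ e
  𝟙⊓⊙       : ∀ {e f} → 𝟙 ⊓ (e ⊙ f) ≐ 𝟙 ⊓ (e ⊓ f)
  𝟙⊓conv    : ∀ {e} → 𝟙 ⊓ conv e ≐ 𝟙 ⊓ e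
  test-comm : ∀ {e f} → (𝟙 ⊓ e) ⊙ f ≐ f ⊙ (𝟙 ⊓ e)
  test-⊓    : ∀ {e f g} → ((𝟙 ⊓ e) ⊙ f) ⊓ g ≐ (𝟙 ⊓ e) ⊙ (f ⊓ g)
  test-⁺    : ∀ {e f g} → (g ⊕ (𝟙 ⊓ e) ⊙ f) ⁺ ≐ g ⁺ ⊕ (𝟙 ⊓ e) ⊙ (g ⊕ f) ⁺
  ind-l : ∀ {e f} → e ⊙ f ⊕ f ≐ f → e ⁺ ⊙ f ⊕ f ≐ f
  ind-r : ∀ {e f} → f ⊙ e ⊕ f ≐ f → f ⊙ e ⁺ ⊕ f ≐ f

_≦_ : {X : Set} → Expr X → Expr X → Set
e ≦ f = e ⊕ f ≐ f

-- Soundness: each axiom is an equation between languages, and the two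
-- induction rules are instances of the induction principle of L⁺.
-- Completeness for tests: interpret x as {ε} if x ∈ A and as ∅ otherwise.
-- Then t_A ≲ e says ε ∈ ⟦e⟧, and induction on e turns this into t_A ≦ e:
-- as t_A ≦ 1, it only sees the ε-part 1 ⊓ g of an expression g, and the
-- axioms 1 ⊓ (e · f) = 1 ⊓ (e ⊓ f) and 1 ⊓ ē = 1 ⊓ e reduce products and
-- converses to their arguments.
module Submission where

open import Defs
open import Data.List using (List; []; _∷_; _++_; reverse)
open import Data.List.Properties
  using (++-assoc; ++-identityʳ; ++-conicalˡ; ++-conicalʳ; reverse-++; reverse-involutive)
open import Data.List.Membership.Propositional using (_∈_)
open import Data.List.Relation.Unary.All using (All; []; _∷_; tabulate)
open import Data.List.Relation.Unary.Any using (here; there)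
open import Data.List.Relation.Unary.Unique.Propositional using (Unique)
open import Data.Product using (Σ; _×_; _,_; proj₁)
open import Data.Sum using (inj₁; inj₂; [_,_])
open import Data.Unit using (⊤)
open import Function using (id)
open import Function.Bundles using (_⇔_; mk⇔)
open import Relation.Binary.PropositionalEquality using (_≡_; refl; sym; trans; subst; cong)
open import Relation.Unary using (_⊆_; ∅; _∪_; _∩_) renaming (_≐_ to _≃_)
open import Relation.Unary.Properties using (≐-refl; ≐-sym; ≐-trans)
open import Relation.Unary.Algebra
  using (∪-cong; ∩-cong; ∪-comm; ∪-assoc; ∩-comm; ∩-idem; ∩-assoc; ∩-distribʳ-∪; ∪-abs-∩)

module Language {A : Set} where

  infixl 7 _·_

  ε : Lang A
  ε w = w ≡ []

  _·_ : Lang A → Lang A → Lang A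
  (L · M) w = Σ (List A) λ u → Σ (List A) λ v → (w ≡ u ++ v) × (L u × M v)

  rev : Lang A → Lang A
  rev L w = L (reverse w)

  variable
    L L′ M M′ N T : Lang A

  ∪-≃ʳ⇒⊆ : L ∪ M ≃ M → L ⊆ M
  ∪-≃ʳ⇒⊆ (L∪M⊆M , _) l = L∪M⊆M (inj₁ l)

  ⊆⇒∪-≃ʳ : L ⊆ M → L ∪ M ≃ M
  ⊆⇒∪-≃ʳ L⊆M = [ L⊆M , id ] , inj₂

  ∪-identityʳ : L ∪ ∅ ≃ L
  ∪-identityʳ = [ id , (λ ()) ] , inj₁

  ·-mono : L ⊆ L′ → M ⊆ M′ → L · M ⊆ L′ · M′
  ·-mono p q (u , v , eq , l , m) = u , v , eq , p l , q m

  ·-cong : L ≃ L′ → M ≃ M′ → L · M ≃ L′ · M′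
  ·-cong (p , p′) (q , q′) = ·-mono p q , ·-mono p′ q′

  ·-assoc : L · (M · N) ≃ (L · M) · N
  ·-assoc =
    (λ { (u , _ , refl , l , (u′ , v′ , refl , m , n)) →
         u ++ u′ , v′ , sym (++-assoc u u′ v′) , (u , u′ , refl , l , m) , n }) ,
    (λ { (_ , v , refl , (u′ , v′ , refl , l , m) , n) →
         u′ , v′ ++ v , ++-assoc u′ v′ v , l , (v′ , v , refl , m , n) })

  ·-zeroˡ : ∅ · L ≃ ∅
  ·-zeroˡ = (λ { (_ , _ , _ , () , _) }) , λ ()

  ·-zeroʳ : L · ∅ ≃ ∅
  ·-zeroʳ = (λ { (_ , _ , _ , _ , ()) }) , λ ()

  ·-distribʳ-∪ : (L ∪ M) · N ≃ L · N ∪ M · N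
  ·-distribʳ-∪ =
    (λ { (u , v , eq , inj₁ l , n) → inj₁ (u , v , eq , l , n)
       ; (u , v , eq , inj₂ m , n) → inj₂ (u , v , eq , m , n) }) ,
    [ ·-mono inj₁ id , ·-mono inj₂ id ]

  ·-distribˡ-∪ : L · (M ∪ N) ≃ L · M ∪ L · N
  ·-distribˡ-∪ =
    (λ { (u , v , eq , l , inj₁ m) → inj₁ (u , v , eq , l , m)
       ; (u , v , eq , l , inj₂ n) → inj₂ (u , v , eq , l , n) }) ,
    [ ·-mono id inj₁ , ·-mono id inj₂ ]

  ·-identityˡ : ε · L ≃ L
  ·-identityˡ = (λ { (_ , _ , refl , refl , l) → l }) , λ l → [] , _ , refl , refl , l

  ·-identityʳ : L · ε ≃ L
  ·-identityʳ {L} =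
    (λ { (u , _ , refl , l , refl) → subst L (sym (++-identityʳ u)) l }) ,
    λ {w} l → w , [] , sym (++-identityʳ w) , l , refl

  ε∩-· : ε ∩ (L · M) ≃ ε ∩ (L ∩ M)
  ε∩-· {L} {M} =
    (λ { (refl , u , v , eq , l , m) →
         refl , subst L (++-conicalˡ u v (sym eq)) l , subst M (++-conicalʳ u v (sym eq)) m }) ,
    λ { (refl , l , m) → refl , [] , [] , refl , l , m }

  ε∩-rev : ε ∩ rev L ≃ ε ∩ L
  ε∩-rev = (λ { (refl , l) → refl , l }) , λ { (refl , l) → refl , l }

  rev-cong : L ≃ M → rev L ≃ rev M
  rev-cong (L⊆M , M⊆L) = L⊆M , M⊆L

  rev-involutive : rev (rev L) ≃ L
  rev-involutive {L} =
    (λ {w} → subst L (reverse-involutive w)) , λ {w} → subst L (sym (reverse-involutive w))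

  rev-· : rev (L · M) ≃ rev M · rev L
  rev-· {L} {M} =
    (λ { {w} (u , v , eq , l , m) →
         reverse v , reverse u ,
         trans (sym (reverse-involutive w)) (trans (cong reverse eq) (reverse-++ u v)) ,
         subst M (sym (reverse-involutive v)) m , subst L (sym (reverse-involutive u)) l }) ,
    λ { (u , v , refl , m , l) → reverse v , reverse u , reverse-++ u v , l , m }

  test-·-comm : (ε ∩ T) · L ≃ L · (ε ∩ T)
  test-·-comm =
    (λ { (_ , v , refl , t@(refl , _) , l) → v , [] , sym (++-identityʳ v) , l , t }) ,
    λ { (u , _ , refl , l , t@(refl , _)) → [] , u , ++-identityʳ u , t , l }

  test-·-∩ : ((ε ∩ T) · L) ∩ M ≃ (ε ∩ T) · (L ∩ M)
  test-·-∩ =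
    (λ { ((_ , v , refl , (refl , t) , l) , m) → [] , v , refl , (refl , t) , (l , m) }) ,
    λ { (_ , v , refl , (refl , t) , (l , m)) → ([] , v , refl , (refl , t) , l) , m }

  Plus-mono : L ⊆ M → Plus L ⊆ Plus M
  Plus-mono L⊆M (one l)    = one (L⊆M l)
  Plus-mono L⊆M (more l p) = more (L⊆M l) (Plus-mono L⊆M p)

  Plus-cong : L ≃ M → Plus L ≃ Plus M
  Plus-cong (L⊆M , M⊆L) = Plus-mono L⊆M , Plus-mono M⊆L

  Plus-nil : ∀ {w} → Plus L w → w ≡ [] → L []
  Plus-nil (one l) refl = l
  Plus-nil {L} (more {u} {v} l _) eq = subst L (++-conicalˡ u v eq) l

  Plus-snoc : ∀ {u v} → Plus L u → L v → Plus L (u ++ v)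
  Plus-snoc (one l) l′ = more l (one l′)
  Plus-snoc {L} {v = v} (more {u₁} {u₂} l p) l′ =
    subst (Plus L) (sym (++-assoc u₁ u₂ v)) (more l (Plus-snoc p l′))

  Plus-unsnoc : Plus L ⊆ L ∪ Plus L · L
  Plus-unsnoc (one l) = inj₁ l
  Plus-unsnoc (more {u} {v} l p) with Plus-unsnoc p
  ... | inj₁ l′ = inj₂ (u , v , refl , one l , l′)
  ... | inj₂ (u′ , v′ , refl , p′ , l′) =
    inj₂ (u ++ u′ , v′ , sym (++-assoc u u′ v′) , more l p′ , l′)

  Plus-unfoldˡ : Plus L ≃ L ∪ L · Plus L
  Plus-unfoldˡ =
    (λ { (one l) → inj₁ l ; (more l p) → inj₂ (_ , _ , refl , l , p) }) ,
    [ one , (λ { (_ , _ , refl , l , p) → more l p }) ]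

  Plus-unfoldʳ : Plus L ≃ L ∪ Plus L · L
  Plus-unfoldʳ = Plus-unsnoc , [ one , (λ { (_ , _ , refl , p , l) → Plus-snoc p l }) ]

  Plus-reverse : (∀ {u} → L u → M (reverse u)) → ∀ {w} → Plus L w → Plus M (reverse w)
  Plus-reverse f (one l) = one (f l)
  Plus-reverse {M = M} f (more {u} {v} l p) =
    subst (Plus M) (sym (reverse-++ u v)) (Plus-snoc (Plus-reverse f p) (f l))

  rev-Plus : rev (Plus L) ≃ Plus (rev L)
  rev-Plus {L} =
    (λ {w} p → subst (Plus (rev L)) (reverse-involutive w)
                 (Plus-reverse (λ {u} → subst L (sym (reverse-involutive u))) p)) ,
    Plus-reverse id

  Plus-indˡ : L · M ⊆ M → Plus L · M ⊆ M
  Plus-indˡ {L} {M} L·M⊆M (_ , _ , refl , p , m) = go p m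
    where
      go : ∀ {u v} → Plus L u → M v → M (u ++ v)
      go (one l) m = L·M⊆M (_ , _ , refl , l , m)
      go {v = v} (more {u₁} {u₂} l p) m =
        subst M (sym (++-assoc u₁ u₂ v)) (L·M⊆M (_ , _ , refl , l , go p m))

  Plus-indʳ : M · L ⊆ M → M · Plus L ⊆ M
  Plus-indʳ {M} {L} M·L⊆M (_ , _ , refl , m , p) = go m p
    where
      go : ∀ {u v} → M u → Plus L v → M (u ++ v)
      go m (one l) = M·L⊆M (_ , _ , refl , m , l)
      go {u} m (more {v₁} {v₂} l p) =
        subst M (++-assoc u v₁ v₂) (go (M·L⊆M (_ , _ , refl , m , l)) p)

  Plus-test : Plus (N ∪ (ε ∩ T) · L) ≃ Plus N ∪ (ε ∩ T) · Plus (N ∪ L)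
  Plus-test {N} {T} {L} = split , [ Plus-mono inj₁ , join ]
    where
      drop-test : N ∪ (ε ∩ T) · L ⊆ N ∪ L
      drop-test (inj₁ n) = inj₁ n
      drop-test (inj₂ (_ , _ , refl , (refl , _) , l)) = inj₂ l

      split : Plus (N ∪ (ε ∩ T) · L) ⊆ Plus N ∪ (ε ∩ T) · Plus (N ∪ L)
      split (one (inj₁ n)) = inj₁ (one n)
      split (one (inj₂ (_ , _ , refl , t@(refl , _) , l))) = inj₂ ([] , _ , refl , t , one (inj₂ l))
      split (more x p) with x | split p
      ... | inj₁ n | inj₁ q = inj₁ (more n q)
      ... | inj₂ (_ , _ , refl , t@(refl , _) , l) | inj₁ q =
        inj₂ ([] , _ , refl , t , more (inj₂ l) (Plus-mono inj₁ q))
      ... | _ | inj₂ (_ , _ , refl , t@(refl , _) , q) = inj₂ ([] , _ , refl , t , more (drop-test x) q)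

      join : (ε ∩ T) · Plus (N ∪ L) ⊆ Plus (N ∪ (ε ∩ T) · L)
      join (_ , _ , refl , t@(refl , _) , q) =
        Plus-mono [ inj₁ , (λ l → inj₂ ([] , _ , refl , t , l)) ] q

open Language

module _ {X A : Set} (σ : X → Lang A) where

  sound : {e f : Expr X} → e ≐ f → ⟦ e ⟧ σ ≃ ⟦ f ⟧ σ
  sound refl≐          = ≐-refl
  sound (sym≐ p)       = ≐-sym (sound p)
  sound (trans≐ p q)   = ≐-trans (sound p) (sound q)
  sound (⊕-cong p q)   = ∪-cong (sound p) (sound q)
  sound (⊙-cong p q)   = ·-cong (sound p) (sound q)
  sound (⊓-cong p q)   = ∩-cong (sound p) (sound q)
  sound (⁺-cong p)     = Plus-cong (sound p)
  sound (conv-cong p)  = rev-cong (sound p)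
  sound ⊕-comm         = ∪-comm _ _
  sound ⊕-assoc        = ≐-sym (∪-assoc _ _ _)
  sound ⊕-zero         = ∪-identityʳ
  sound ⊓-comm         = ∩-comm _ _
  sound ⊓-idem         = ∩-idem _
  sound ⊓-assoc        = ≐-sym (∩-assoc _ _ _)
  sound ⊓-distr        = ∩-distribʳ-∪ _ _ _
  sound absorb         = ≐-trans (∪-comm _ _) (∪-abs-∩ _ _)
  sound ⊙-assoc        = ·-assoc
  sound ⊙-zeroʳ        = ·-zeroʳ
  sound ⊙-zeroˡ        = ·-zeroˡ
  sound ⊙-distrʳ       = ·-distribʳ-∪
  sound ⊙-distrˡ       = ·-distribˡ-∪
  sound ⁺-unfoldˡ      = Plus-unfoldˡ
  sound ⁺-unfoldʳ      = Plus-unfoldʳ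
  sound conv-inv       = rev-involutive
  sound conv-⊕         = ≐-refl
  sound conv-⊙         = rev-·
  sound conv-⊓         = ≐-refl
  sound conv-⁺         = rev-Plus
  sound ⊙-unitˡ        = ·-identityˡ
  sound ⊙-unitʳ        = ·-identityʳ
  sound 𝟙⊓⊙            = ε∩-·
  sound 𝟙⊓conv         = ε∩-rev
  sound test-comm      = test-·-comm
  sound test-⊓         = test-·-∩
  sound test-⁺         = Plus-test
  sound (ind-l p)      = ⊆⇒∪-≃ʳ (Plus-indˡ (∪-≃ʳ⇒⊆ (sound p)))
  sound (ind-r p)      = ⊆⇒∪-≃ʳ (Plus-indʳ (∪-≃ʳ⇒⊆ (sound p)))

≦⇒≲ : {X : Set} {e f : Expr X} → e ≦ f → e ≲ f
≦⇒≲ e≦f _ σ _ = ∪-≃ʳ⇒⊆ (sound σ e≦f)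

module _ {X : Set} where

  ≦-refl : {e : Expr X} → e ≦ e
  ≦-refl = trans≐ (⊕-cong (sym≐ ⊓-idem) refl≐) absorb

  ≦-trans : {e f g : Expr X} → e ≦ f → f ≦ g → e ≦ g
  ≦-trans e≦f f≦g =
    trans≐ (⊕-cong refl≐ (sym≐ f≦g)) (trans≐ ⊕-assoc (trans≐ (⊕-cong e≦f refl≐) f≦g))

  ≦-respʳ-≐ : {e f f′ : Expr X} → e ≦ f → f ≐ f′ → e ≦ f′
  ≦-respʳ-≐ e≦f f≐f′ = trans≐ (⊕-cong refl≐ (sym≐ f≐f′)) (trans≐ e≦f f≐f′)

  ≦-respˡ-≐ : {e e′ f : Expr X} → e ≐ e′ → e ≦ f → e′ ≦ f
  ≦-respˡ-≐ e≐e′ e≦f = trans≐ (⊕-cong (sym≐ e≐e′) refl≐) e≦f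

  e⊓f≦e : {e f : Expr X} → (e ⊓ f) ≦ e
  e⊓f≦e = absorb

  e⊓f≦f : {e f : Expr X} → (e ⊓ f) ≦ f
  e⊓f≦f = ≦-respˡ-≐ ⊓-comm e⊓f≦e

  e≦e⊕f : {e f : Expr X} → e ≦ (e ⊕ f)
  e≦e⊕f = trans≐ ⊕-assoc (⊕-cong ≦-refl refl≐)

  f≦e⊕f : {e f : Expr X} → f ≦ (e ⊕ f)
  f≦e⊕f = ≦-respʳ-≐ e≦e⊕f ⊕-comm

  ⊓-monoˡ-≦ : {e f g : Expr X} → e ≦ f → (e ⊓ g) ≦ (f ⊓ g)
  ⊓-monoˡ-≦ e≦f = trans≐ (sym≐ ⊓-distr) (⊓-cong e≦f refl≐)

  ⊓-greatest : {s e f : Expr X} → s ≦ e → s ≦ f → s ≦ (e ⊓ f)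
  ⊓-greatest s≦e s≦f =
    ≦-respˡ-≐ ⊓-idem (≦-trans (⊓-monoˡ-≦ s≦e)
      (≦-respˡ-≐ ⊓-comm (≦-respʳ-≐ (⊓-monoˡ-≦ s≦f) ⊓-comm)))

  subunit-≦-transfer : {s g h : Expr X} → s ≦ 𝟙 → 𝟙 ⊓ g ≐ 𝟙 ⊓ h → s ≦ g → s ≦ h
  subunit-≦-transfer s≦𝟙 eq s≦g = ≦-trans (≦-respʳ-≐ (⊓-greatest s≦𝟙 s≦g) eq) e⊓f≦f

  t≦𝟙 : (A : List X) → t A ≦ 𝟙
  t≦𝟙 []       = ≦-refl
  t≦𝟙 (a ∷ as) = ≦-trans e⊓f≦f (t≦𝟙 as)

  t≦var : {x : X} (A : List X) → x ∈ A → t A ≦ var x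
  t≦var (a ∷ as) (here refl) = e⊓f≦e
  t≦var (a ∷ as) (there x∈as) = ≦-trans e⊓f≦f (t≦var as x∈as)

ε∈⟦t⟧ : {X A : Set} {σ : X → Lang A} (B : List X) → All (λ x → σ x []) B → ⟦ t B ⟧ σ []
ε∈⟦t⟧ []       []         = refl
ε∈⟦t⟧ (b ∷ bs) (εb ∷ εbs) = εb , ε∈⟦t⟧ bs εbs

σ[_] : {X : Set} → List X → X → Lang ⊤
σ[ A ] x w = (w ≡ []) × (x ∈ A)

ε∈⇒t≦ : {X : Set} (A : List X) (e : Expr X) → ⟦ e ⟧ σ[ A ] [] → t A ≦ e
ε∈⇒t≦ A (var x) (_ , x∈A) = t≦var A x∈A
ε∈⇒t≦ A 𝟘 ()
ε∈⇒t≦ A 𝟙 _ = t≦𝟙 A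
ε∈⇒t≦ A (e ⊕ f) (inj₁ εe) = ≦-trans (ε∈⇒t≦ A e εe) e≦e⊕f
ε∈⇒t≦ A (e ⊕ f) (inj₂ εf) = ≦-trans (ε∈⇒t≦ A f εf) f≦e⊕f
ε∈⇒t≦ A (e ⊙ f) εef =
  let (_ , εe , εf) = proj₁ ε∩-· (refl , εef) in
  subunit-≦-transfer (t≦𝟙 A) (sym≐ 𝟙⊓⊙) (⊓-greatest (ε∈⇒t≦ A e εe) (ε∈⇒t≦ A f εf))
ε∈⇒t≦ A (e ⊓ f) (εe , εf) = ⊓-greatest (ε∈⇒t≦ A e εe) (ε∈⇒t≦ A f εf)
ε∈⇒t≦ A (e ⁺) εe⁺ = ≦-trans (ε∈⇒t≦ A e (Plus-nil εe⁺ refl)) (≦-respʳ-≐ e≦e⊕f (sym≐ ⁺-unfoldˡ))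
ε∈⇒t≦ A (conv e) εe = subunit-≦-transfer (t≦𝟙 A) (sym≐ 𝟙⊓conv) (ε∈⇒t≦ A e εe)

-- The argument never uses that A is duplicate-free.
corollary14 : {X : Set} (e : Expr X) (A : List X) → Unique A → (t A ≦ e) ⇔ (t A ≲ e)
corollary14 e A _ = mk⇔ ≦⇒≲ λ t≲e →
  ε∈⇒t≦ A e (t≲e ⊤ σ[ A ] [] (ε∈⟦t⟧ A (tabulate (refl ,_))))
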